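{- Let $f\colon \mathbb{N}\to\mathbb{R}^{\geq 0}$ be the function defined in the context. Then $\sup_{i\geq 0} f(i) = 1+\sum_{n=1}^\infty \frac{1}{F_{2n}}$ (in particular, this series converges).
   Context: $\mathbb{N}=\{0,1,2,\dots\}$. Let $F_n$ denote the Fibonacci numbers, $F_0=0$, $F_1=1$, $F_n=F_{n-1}+F_{n-2}$ for $n>1$, and let $u_i=F_{2i}$ for $i\geq 1$. Every $N\in\mathbb{N}$ has a unique representation $N=\sum_{i=1}^\infty d_iu_i$ with digits $d_i\in\{0,1,2\}$, only finitely many nonzero, such that whenever $i<j$ and $d_i=d_j=2$ there exists $l$ with $i<l<j$ and $d_l=0$. For $a\in\mathbb{N}$ write $d^a_i$ for the digits of this representation of $a$, and define $f(a)=\sum_{i=1}^\infty \frac{d^a_i}{u_i}$. -}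

module Defs where

open import Data.Nat as ℕ using (ℕ; zero; suc)
open import Data.Integer using (+_)
open import Data.Rational as ℚ using (ℚ; 0ℚ; 1ℚ; _/_)
open import Data.Product using (Σ; ∃; _×_; _,_)
open import Relation.Binary.PropositionalEquality using (_≡_)

fib : ℕ → ℕ
fib zero = 0
fib (suc zero) = 1
fib (suc (suc n)) = fib (suc n) ℕ.+ fib n

u : ℕ → ℕ
u i = fib (2 ℕ.* i)

-- 1/n as a rational, for n ≥ 1 (the value at 0 is never used, since u_i ≥ 1 for i ≥ 1)
recipℕ : ℕ → ℚ
recipℕ zero = 0ℚ
recipℕ (suc k) = + 1 / suc k

toℚ : ℕ → ℚ
toℚ n = + n / 1

digitValue : (ℕ → ℕ) → ℕ → ℕ
digitValue d zero = 0
digitValue d (suc K) = digitValue d K ℕ.+ d (suc K) ℕ.* u (suc K)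

fSum : (ℕ → ℕ) → ℕ → ℚ
fSum d zero = 0ℚ
fSum d (suc K) = fSum d K ℚ.+ toℚ (d (suc K)) ℚ.* recipℕ (u (suc K))

-- The digit sequence d = (d_1, d_2, ...) (d 0 is an unused dummy, set to 0),
-- with all digits zero beyond index K, is the representation of N from the context:
-- digits in {0,1,2}, between any two 2's there is a 0, and Σ d_i u_i = N.
IsRep : ℕ → ℕ → (ℕ → ℕ) → Set
IsRep N K d =
  (d 0 ≡ 0) ×
  (∀ i → d i ℕ.≤ 2) ×
  (∀ i → K ℕ.< i → d i ≡ 0) ×
  (∀ i j → i ℕ.< j → d i ≡ 2 → d j ≡ 2 →
     ∃ λ l → (i ℕ.< l) × (l ℕ.< j) × (d l ≡ 0)) ×
  (digitValue d K ≡ N)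

-- f(a) = q : q is Σ d^a_i / u_i for the representation of a
-- (well defined by uniqueness of the representation; trailing zero digits do not change the sum)
fIs : ℕ → ℚ → Set
fIs a q = Σ ℕ λ K → Σ (ℕ → ℕ) λ d → IsRep a K d × (q ≡ fSum d K)

S : ℕ → ℚ
S zero = 1ℚ
S (suc m) = S m ℚ.+ recipℕ (u (suc m))

{-# OPTIONS --safe #-}
-- Write w_i = 1/F_{2i}. Then w_1 = 1 and 2 w_{i+1} ≤ w_i, since F_{2i+2} = 2 F_{2i} + F_{2i-1};
-- so S_m + 2 w_{m+1} decreases in m, which bounds the partial sums. Against the all-ones digit
-- string, a digit 2 at position i gains w_i and a digit 0 loses w_i. A 0 separates any two 2s
-- and w decreases, so every 2 but the last is paid for by the next 0, and the last gain is at
-- most w_1 = 1. By induction on K: Σ_{i≤K} d_i w_i ≤ S_K, and even ≤ S_K − w_{K+1} once every 2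
-- among the first K digits is followed by a 0 among them. The digits 2,1,…,1 attain S_{m+1}.
module Submission where

open import Defs
open import Data.Nat using (ℕ)
open import Data.Rational using (ℚ; 0ℚ; _≤_; _<_; _+_)
open import Data.Product using (Σ; ∃; _×_)

open import Data.Nat as ℕ using (zero; suc; s≤s)
import Data.Nat.Properties as ℕₚ
open import Data.Nat.Solver using (module +-*-Solver)
import Data.Integer as ℤ
import Data.Integer.Properties as ℤₚ
open import Data.Rational as ℚ using (toℚᵘ)
import Data.Rational.Properties as ℚₚ
open import Data.Rational.Unnormalised as ℚᵘ using (mkℚᵘ; *≤*)
import Data.Rational.Unnormalised.Properties as ℚᵘₚ
open import Data.Product using (_,_; proj₁; map₂)
open import Data.Empty using (⊥-elim)
open import Data.Sum using (_⊎_; inj₁; inj₂)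
open import Function using (case_of_)
open import Relation.Nullary using (¬_; yes; no)
open import Relation.Binary.PropositionalEquality
  using (_≡_; refl; sym; trans; cong; cong₂; subst₂; module ≡-Reasoning)

p≤p+q : ∀ p {q} → 0ℚ ≤ q → p ≤ p + q
p≤p+q p 0≤q = subst₂ _≤_ (ℚₚ.+-identityʳ p) refl (ℚₚ.+-monoʳ-≤ p 0≤q)

≤-+-pos : ∀ {p q ε} → 0ℚ < ε → p ≤ q → p ≤ q + ε
≤-+-pos {q = q} 0<ε p≤q = ℚₚ.≤-trans p≤q (p≤p+q q (ℚₚ.<⇒≤ 0<ε))

recipℕ-nonneg : ∀ n → 0ℚ ≤ recipℕ n
recipℕ-nonneg zero    = ℚₚ.≤-refl
recipℕ-nonneg (suc k) = ℚₚ.nonNegative⁻¹ _ {{ℚₚ.normalize-nonNeg 1 (suc k)}}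

mkℚᵘ-≤ : ∀ {m c n d} → m ℕ.* suc d ℕ.≤ n ℕ.* suc c → mkℚᵘ (ℤ.+ m) c ℚᵘ.≤ mkℚᵘ (ℤ.+ n) d
mkℚᵘ-≤ {m} {c} {n} {d} h = *≤* (subst₂ ℤ._≤_ (ℤₚ.pos-* m (suc d)) (ℤₚ.pos-* n (suc c)) (ℤ.+≤+ h))

recipℕ-halving : ∀ {m n} → 0 ℕ.< m → 2 ℕ.* m ℕ.≤ n → recipℕ n + recipℕ n ≤ recipℕ m
recipℕ-halving {suc a} {suc b} _ 2m≤n = ℚₚ.toℚᵘ-cancel-≤ (begin
  toℚᵘ (recipℕ (suc b) + recipℕ (suc b))
    ≃⟨ ℚₚ.toℚᵘ-homo-+ (recipℕ (suc b)) (recipℕ (suc b)) ⟩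
  toℚᵘ (recipℕ (suc b)) ℚᵘ.+ toℚᵘ (recipℕ (suc b))
    ≃⟨ ℚᵘₚ.+-cong (ℚₚ.toℚᵘ-fromℚᵘ (mkℚᵘ (ℤ.+ 1) b)) (ℚₚ.toℚᵘ-fromℚᵘ (mkℚᵘ (ℤ.+ 1) b)) ⟩
  mkℚᵘ (ℤ.+ 1) b ℚᵘ.+ mkℚᵘ (ℤ.+ 1) b
    ≤⟨ mkℚᵘ-≤ (subst₂ ℕ._≤_ cross-multiplied (sym (ℕₚ.*-identityˡ _)) (ℕₚ.*-monoʳ-≤ (suc b) 2m≤n)) ⟩
  mkℚᵘ (ℤ.+ 1) a
    ≃⟨ ℚᵘₚ.≃-sym (ℚₚ.toℚᵘ-fromℚᵘ (mkℚᵘ (ℤ.+ 1) a)) ⟩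
  toℚᵘ (recipℕ (suc a)) ∎)
  where
  open ℚᵘₚ.≤-Reasoning
  open +-*-Solver
  cross-multiplied : suc b ℕ.* (2 ℕ.* suc a) ≡ (1 ℕ.* suc b ℕ.+ 1 ℕ.* suc b) ℕ.* suc a
  cross-multiplied = solve 2 (λ a b → b :* (con 2 :* a) := (con 1 :* b :+ con 1 :* b) :* a)
    refl (suc a) (suc b)

fib-pos : ∀ n → 0 ℕ.< fib (suc n)
fib-pos zero    = s≤s ℕ.z≤n
fib-pos (suc n) = ℕₚ.≤-trans (fib-pos n) (ℕₚ.m≤m+n (fib (suc n)) (fib n))

fib-double≤ : ∀ n → 2 ℕ.* fib (suc n) ℕ.≤ fib (3 ℕ.+ n)
fib-double≤ n = begin
  2 ℕ.* fib (suc n)                    ≡⟨ cong (fib (suc n) ℕ.+_) (ℕₚ.+-identityʳ (fib (suc n))) ⟩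
  fib (suc n) ℕ.+ fib (suc n)          ≤⟨ ℕₚ.+-monoˡ-≤ (fib (suc n)) (ℕₚ.m≤m+n (fib (suc n)) (fib n)) ⟩
  fib (suc n) ℕ.+ fib n ℕ.+ fib (suc n) ∎
  where open ℕₚ.≤-Reasoning

u-suc : ∀ n → u (suc n) ≡ fib (2 ℕ.+ 2 ℕ.* n)
u-suc n = cong fib (ℕₚ.*-suc 2 n)

u-pos : ∀ n → 0 ℕ.< u (suc n)
u-pos n = subst₂ ℕ._<_ refl (sym (u-suc n)) (fib-pos (suc (2 ℕ.* n)))

u-double≤ : ∀ n → 2 ℕ.* u (suc n) ℕ.≤ u (2 ℕ.+ n)
u-double≤ n = begin
  2 ℕ.* u (suc n)             ≡⟨ cong (2 ℕ.*_) (u-suc n) ⟩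
  2 ℕ.* fib (2 ℕ.+ 2 ℕ.* n)   ≤⟨ fib-double≤ (1 ℕ.+ 2 ℕ.* n) ⟩
  fib (4 ℕ.+ 2 ℕ.* n)         ≡⟨ cong (λ k → fib (2 ℕ.+ k)) (ℕₚ.*-suc 2 n) ⟨
  fib (2 ℕ.+ 2 ℕ.* suc n)     ≡⟨ u-suc (suc n) ⟨
  u (2 ℕ.+ n)                 ∎
  where open ℕₚ.≤-Reasoning

1/u : ℕ → ℚ
1/u i = recipℕ (u i)

1/u-nonneg : ∀ i → 0ℚ ≤ 1/u i
1/u-nonneg i = recipℕ-nonneg (u i)

1/u-halving : ∀ n → 1/u (2 ℕ.+ n) + 1/u (2 ℕ.+ n) ≤ 1/u (suc n)
1/u-halving n = recipℕ-halving (u-pos n) (u-double≤ n)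

1/u-antitone : ∀ n → 1/u (2 ℕ.+ n) ≤ 1/u (suc n)
1/u-antitone n = ℚₚ.≤-trans (p≤p+q _ (1/u-nonneg (2 ℕ.+ n))) (1/u-halving n)

S-+-double-tail-step : ∀ m →
  S (suc m) + (1/u (2 ℕ.+ m) + 1/u (2 ℕ.+ m)) ≤ S m + (1/u (suc m) + 1/u (suc m))
S-+-double-tail-step m = begin
  S m + 1/u (suc m) + (1/u (2 ℕ.+ m) + 1/u (2 ℕ.+ m))   ≡⟨ ℚₚ.+-assoc (S m) (1/u (suc m)) _ ⟩
  S m + (1/u (suc m) + (1/u (2 ℕ.+ m) + 1/u (2 ℕ.+ m))) ≤⟨ ℚₚ.+-monoʳ-≤ (S m) (ℚₚ.+-monoʳ-≤ (1/u (suc m)) (1/u-halving m)) ⟩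
  S m + (1/u (suc m) + 1/u (suc m))                     ∎
  where open ℚₚ.≤-Reasoning

S-+-double-tail-≤ : ∀ m → S m + (1/u (suc m) + 1/u (suc m)) ≤ S 0 + (1/u 1 + 1/u 1)
S-+-double-tail-≤ zero    = ℚₚ.≤-refl
S-+-double-tail-≤ (suc m) = ℚₚ.≤-trans (S-+-double-tail-step m) (S-+-double-tail-≤ m)

S-bounded : ∀ m → S m ≤ S 0 + (1/u 1 + 1/u 1)
S-bounded m = ℚₚ.≤-trans (p≤p+q (S m) (ℚₚ.+-mono-≤ (1/u-nonneg (suc m)) (1/u-nonneg (suc m))))
                         (S-+-double-tail-≤ m)

TwosSeparated : (ℕ → ℕ) → Set
TwosSeparated d = ∀ i j → i ℕ.< j → d i ≡ 2 → d j ≡ 2 → ∃ λ l → i ℕ.< l × l ℕ.< j × d l ≡ 0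

TwosClosed : (ℕ → ℕ) → ℕ → Set
TwosClosed d K = ∀ i → i ℕ.≤ K → d i ≡ 2 → ∃ λ l → i ℕ.< l × l ℕ.≤ K × d l ≡ 0

Bounded : (ℕ → ℕ) → ℕ → Set
Bounded d K = fSum d K ≤ S K × (TwosClosed d K → fSum d K + 1/u (suc K) ≤ S K)

module _ {d : ℕ → ℕ} {K : ℕ} where

  fSum-digit0 : d (suc K) ≡ 0 → fSum d (suc K) ≡ fSum d K
  fSum-digit0 e rewrite e = trans (cong (fSum d K +_) (ℚₚ.*-zeroˡ (1/u (suc K)))) (ℚₚ.+-identityʳ (fSum d K))

  fSum-digit1 : d (suc K) ≡ 1 → fSum d (suc K) ≡ fSum d K + 1/u (suc K)
  fSum-digit1 e rewrite e = cong (fSum d K +_) (ℚₚ.*-identityˡ (1/u (suc K)))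

  fSum-digit2 : d (suc K) ≡ 2 → fSum d (suc K) ≡ fSum d K + 1/u (suc K) + 1/u (suc K)
  fSum-digit2 e rewrite e = begin
    fSum d K + toℚ 2 ℚ.* w                      ≡⟨ cong (fSum d K +_) (ℚₚ.*-distribʳ-+ w ℚ.1ℚ ℚ.1ℚ) ⟩
    fSum d K + (ℚ.1ℚ ℚ.* w + ℚ.1ℚ ℚ.* w)         ≡⟨ cong (fSum d K +_) (cong₂ _+_ (ℚₚ.*-identityˡ w) (ℚₚ.*-identityˡ w)) ⟩
    fSum d K + (w + w)                          ≡⟨ ℚₚ.+-assoc (fSum d K) w w ⟨
    fSum d K + w + w                            ∎
    where
    open ≡-Reasoning
    w = 1/u (suc K)

  closed-after-one : d (suc K) ≡ 1 → TwosClosed d (suc K) → TwosClosed d K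
  closed-after-one e closed i i≤K di with closed i (ℕₚ.m≤n⇒m≤1+n i≤K) di
  ... | l , i<l , l≤1+K , dl with ℕₚ.m≤n⇒m<n∨m≡n l≤1+K
  ...   | inj₁ (s≤s l≤K) = l , i<l , l≤K , dl
  ...   | inj₂ refl      = case trans (sym e) dl of λ ()

  closed-before-two : TwosSeparated d → d (suc K) ≡ 2 → TwosClosed d K
  closed-before-two sep e i i≤K di with sep i (suc K) (s≤s i≤K) di e
  ... | l , i<l , s≤s l≤K , dl = l , i<l , l≤K , dl

  not-closed-at-two : d (suc K) ≡ 2 → ¬ TwosClosed d (suc K)
  not-closed-at-two e closed with closed (suc K) ℕₚ.≤-refl e
  ... | l , K<l , l≤K , _ = ℕₚ.<-irrefl refl (ℕₚ.<-≤-trans K<l l≤K)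

  open ℚₚ.≤-Reasoning

  bounded-digit0 : d (suc K) ≡ 0 → Bounded d K → Bounded d (suc K)
  bounded-digit0 e (fSum≤S , _) =
    (begin
      fSum d (suc K)  ≡⟨ fSum-digit0 e ⟩
      fSum d K        ≤⟨ fSum≤S ⟩
      S K             ≤⟨ p≤p+q (S K) (1/u-nonneg (suc K)) ⟩
      S (suc K)       ∎) ,
    λ _ → begin
      fSum d (suc K) + 1/u (2 ℕ.+ K)  ≡⟨ cong (_+ 1/u (2 ℕ.+ K)) (fSum-digit0 e) ⟩
      fSum d K + 1/u (2 ℕ.+ K)        ≤⟨ ℚₚ.+-mono-≤ fSum≤S (1/u-antitone K) ⟩
      S (suc K)                       ∎

  bounded-digit1 : d (suc K) ≡ 1 → Bounded d K → Bounded d (suc K)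
  bounded-digit1 e (fSum≤S , closed⇒slack) =
    (begin
      fSum d (suc K)            ≡⟨ fSum-digit1 e ⟩
      fSum d K + 1/u (suc K)    ≤⟨ ℚₚ.+-monoˡ-≤ (1/u (suc K)) fSum≤S ⟩
      S (suc K)                 ∎) ,
    λ closed → begin
      fSum d (suc K) + 1/u (2 ℕ.+ K)              ≡⟨ cong (_+ 1/u (2 ℕ.+ K)) (fSum-digit1 e) ⟩
      fSum d K + 1/u (suc K) + 1/u (2 ℕ.+ K)      ≤⟨ ℚₚ.+-mono-≤ (closed⇒slack (closed-after-one e closed)) (1/u-antitone K) ⟩
      S (suc K)                                   ∎

  bounded-digit2 : TwosSeparated d → d (suc K) ≡ 2 → Bounded d K → Bounded d (suc K)
  bounded-digit2 sep e (_ , closed⇒slack) =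
    (begin
      fSum d (suc K)                        ≡⟨ fSum-digit2 e ⟩
      fSum d K + 1/u (suc K) + 1/u (suc K)  ≤⟨ ℚₚ.+-monoˡ-≤ (1/u (suc K)) (closed⇒slack (closed-before-two sep e)) ⟩
      S (suc K)                             ∎) ,
    λ closed → ⊥-elim (not-closed-at-two e closed)

digit-cases : ∀ {n} → n ℕ.≤ 2 → n ≡ 0 ⊎ n ≡ 1 ⊎ n ≡ 2
digit-cases ℕ.z≤n               = inj₁ refl
digit-cases (s≤s ℕ.z≤n)         = inj₂ (inj₁ refl)
digit-cases (s≤s (s≤s ℕ.z≤n))   = inj₂ (inj₂ refl)

bounded : ∀ {d} → (∀ i → d i ℕ.≤ 2) → TwosSeparated d → ∀ K → Bounded d K
bounded digit≤2 sep zero = recipℕ-nonneg 1 , λ _ → ℚₚ.≤-refl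
bounded digit≤2 sep (suc K) with digit-cases (digit≤2 (suc K))
... | inj₁ e        = bounded-digit0 e (bounded digit≤2 sep K)
... | inj₂ (inj₁ e) = bounded-digit1 e (bounded digit≤2 sep K)
... | inj₂ (inj₂ e) = bounded-digit2 sep e (bounded digit≤2 sep K)

fIs-≤-S : ∀ {a q} → fIs a q → ∃ λ K → q ≤ S K
fIs-≤-S (K , d , (_ , digit≤2 , _ , sep , _) , refl) = K , proj₁ (bounded digit≤2 sep K)

twoThenOnes : ℕ → ℕ → ℕ
twoThenOnes m zero          = 0
twoThenOnes m (suc zero)    = 2
twoThenOnes m (suc (suc k)) with k ℕ.<? m
... | yes _ = 1
... | no  _ = 0

module _ (m : ℕ) where

  twoThenOnes-≤2 : ∀ i → twoThenOnes m i ℕ.≤ 2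
  twoThenOnes-≤2 zero          = ℕ.z≤n
  twoThenOnes-≤2 (suc zero)    = ℕₚ.≤-refl
  twoThenOnes-≤2 (suc (suc k)) with k ℕ.<? m
  ... | yes _ = s≤s ℕ.z≤n
  ... | no  _ = ℕ.z≤n

  twoThenOnes-one : ∀ {k} → k ℕ.< m → twoThenOnes m (2 ℕ.+ k) ≡ 1
  twoThenOnes-one {k} k<m with k ℕ.<? m
  ... | yes _   = refl
  ... | no  k≮m = ⊥-elim (k≮m k<m)

  twoThenOnes-vanishes : ∀ i → suc m ℕ.< i → twoThenOnes m i ≡ 0
  twoThenOnes-vanishes (suc (suc k)) (s≤s (s≤s m≤k)) with k ℕ.<? m
  ... | yes k<m = ⊥-elim (ℕₚ.<⇒≱ k<m m≤k)
  ... | no  _   = refl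

  twoThenOnes-two : ∀ i → twoThenOnes m i ≡ 2 → i ≡ 1
  twoThenOnes-two (suc zero)    _ = refl
  twoThenOnes-two (suc (suc k)) e with k ℕ.<? m
  twoThenOnes-two (suc (suc k)) () | yes _
  twoThenOnes-two (suc (suc k)) () | no  _

  twoThenOnes-separated : TwosSeparated (twoThenOnes m)
  twoThenOnes-separated i j i<j di dj with twoThenOnes-two i di | twoThenOnes-two j dj
  ... | refl | refl = ⊥-elim (ℕₚ.<-irrefl refl i<j)

  twoThenOnes-isRep : IsRep (digitValue (twoThenOnes m) (suc m)) (suc m) (twoThenOnes m)
  twoThenOnes-isRep = refl , twoThenOnes-≤2 , twoThenOnes-vanishes , twoThenOnes-separated , refl

  fSum-twoThenOnes : ∀ k → k ℕ.≤ m → fSum (twoThenOnes m) (suc k) ≡ S (suc k)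
  fSum-twoThenOnes zero    _   = refl
  fSum-twoThenOnes (suc k) k<m = trans (fSum-digit1 {K = suc k} (twoThenOnes-one k<m))
                                       (cong (_+ 1/u (2 ℕ.+ k)) (fSum-twoThenOnes k (ℕₚ.<⇒≤ k<m)))

S-≤-fIs : ∀ m → ∃ λ a → ∃ λ q → fIs a q × S m ≤ q
S-≤-fIs m = digitValue (twoThenOnes m) (suc m) , S (suc m) ,
  (suc m , twoThenOnes m , twoThenOnes-isRep m , sym (fSum-twoThenOnes m m ℕₚ.≤-refl)) ,
  p≤p+q (S m) (1/u-nonneg (suc m))

theorem23 :
    -- the series 1 + Σ 1/F_{2n} converges (its partial sums are bounded)
    (∃ λ (B : ℚ) → ∀ m → S m ≤ B) ×
    -- every value f(a) is ≤ the sum of the series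
    (∀ (a : ℕ) (q : ℚ) → fIs a q → ∀ (ε : ℚ) → 0ℚ < ε → ∃ λ m → q ≤ S m + ε) ×
    -- and the values f(a) come arbitrarily close to (every partial sum of) the series
    (∀ (m : ℕ) (ε : ℚ) → 0ℚ < ε → ∃ λ (a : ℕ) → ∃ λ (q : ℚ) → fIs a q × (S m ≤ q + ε))
theorem23 =
  (S 0 + (1/u 1 + 1/u 1) , S-bounded) ,
  (λ a q fa ε 0<ε → map₂ (≤-+-pos 0<ε) (fIs-≤-S fa)) ,
  (λ m ε 0<ε → map₂ (map₂ (map₂ (≤-+-pos 0<ε))) (S-≤-fIs m))
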